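{- Let $M=\langle W,\mathcal{N},\leq,V\rangle$ be the canonical model for $\mathbf{W}$ with $\mathcal{N}_w=\{\widehat{\varphi}:\mathsf{W}\varphi\in w\}$. Then for every formula $\gamma$ and every $w\in W$: $w\Vdash\gamma$ iff $\gamma\in w$.
   Context: Formulas are built from a countable set $PV$ of propositional variables and $\bot$ by $\land,\lor,\rightarrow$ and a unary modal operator $\mathsf{W}$; $\lnot\varphi$ abbreviates $\varphi\to\bot$, $\varphi\leftrightarrow\psi$ abbreviates $(\varphi\to\psi)\land(\psi\to\varphi)$. The logic $\mathbf{W}$ is the smallest set of formulas containing all instances of the axiom schemes of intuitionistic propositional logic and all instances of $\mathsf{W}\varphi\to\lnot\varphi$, closed under modus ponens and the rule: from $\varphi\leftrightarrow\psi$ infer $\mathsf{W}\varphi\leftrightarrow\mathsf{W}\psi$. A prime theory of $\mathbf{W}$ is a set $w$ of formulas with $\mathbf{W}\subseteq w$, closed under modus ponens, $\bot\notin w$, and $\varphi\lor\psi\in w$ implies $\varphi\in w$ or $\psi\in w$. The canonical model: $W$ = all prime theories of $\mathbf{W}$, $w\leq v$ iff $w\subseteq v$, $V(q)=\{w:q\in w\}$, $\widehat{\varphi}=\{z\in W:\varphi\in z\}$. Forcing: $w\nVdash\bot$; $w\Vdash q$ iff $w\in V(q)$; $\land,\lor$ pointwise; $w\Vdash\varphi\to\psi$ iff for all $v\geq w$, $v\nVdash\varphi$ or $v\Vdash\psi$; $w\Vdash\mathsf{W}\varphi$ iff $w\Vdash\lnot\varphi$ and $V(\varphi)\in\mathcal{N}_w$,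 where $V(\varphi)=\{z\in W:z\Vdash\varphi\}$. -}

module Defs where

open import Level using (Level; 0ℓ; Lift) renaming (suc to lsuc)
open import Data.Nat using (ℕ)
open import Data.Empty using (⊥)
open import Data.Product using (Σ; _×_; _,_; proj₁)
open import Data.Sum using (_⊎_)

infixr 6 _∧_
infixr 5 _∨_
infixr 4 _⇒_

data Formula : Set where
  var : ℕ → Formula
  ⊥'  : Formula
  _∧_ : Formula → Formula → Formula
  _∨_ : Formula → Formula → Formula
  _⇒_ : Formula → Formula → Formula
  𝖶   : Formula → Formula

¬' : Formula → Formula
¬' φ = φ ⇒ ⊥'

_⇔'_ : Formula → Formula → Formula
φ ⇔' ψ = (φ ⇒ ψ) ∧ (ψ ⇒ φ)

data ⊢_ : Formula → Set where
  ax-K   : ∀ {φ ψ} → ⊢ (φ ⇒ ψ ⇒ φ)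
  ax-S   : ∀ {φ ψ χ} → ⊢ ((φ ⇒ ψ ⇒ χ) ⇒ (φ ⇒ ψ) ⇒ φ ⇒ χ)
  ax-∧E₁ : ∀ {φ ψ} → ⊢ (φ ∧ ψ ⇒ φ)
  ax-∧E₂ : ∀ {φ ψ} → ⊢ (φ ∧ ψ ⇒ ψ)
  ax-∧I  : ∀ {φ ψ} → ⊢ (φ ⇒ ψ ⇒ φ ∧ ψ)
  ax-∨I₁ : ∀ {φ ψ} → ⊢ (φ ⇒ φ ∨ ψ)
  ax-∨I₂ : ∀ {φ ψ} → ⊢ (ψ ⇒ φ ∨ ψ)
  ax-∨E  : ∀ {φ ψ χ} → ⊢ ((φ ⇒ χ) ⇒ (ψ ⇒ χ) ⇒ φ ∨ ψ ⇒ χ)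
  ax-⊥E  : ∀ {φ} → ⊢ (⊥' ⇒ φ)
  ax-W   : ∀ {φ} → ⊢ (𝖶 φ ⇒ ¬' φ)
  mp     : ∀ {φ ψ} → ⊢ (φ ⇒ ψ) → ⊢ φ → ⊢ ψ
  re     : ∀ {φ ψ} → ⊢ (φ ⇔' ψ) → ⊢ (𝖶 φ ⇔' 𝖶 ψ)

Theory : Set₁
Theory = Formula → Set

record IsPrime (w : Theory) : Set where
  field
    contains-W : ∀ {φ} → ⊢ φ → w φ
    closed-mp  : ∀ {φ ψ} → w (φ ⇒ ψ) → w φ → w ψ
    consistent : w ⊥' → ⊥
    prime      : ∀ {φ ψ} → w (φ ∨ ψ) → w φ ⊎ w ψ

World : Set₁
World = Σ Theory IsPrime

_∈_ : Formula → World → Set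
φ ∈ w = proj₁ w φ

_≤_ : World → World → Set
w ≤ v = ∀ φ → φ ∈ w → φ ∈ v

Val : ℕ → World → Set
Val q w = var q ∈ w

-- Neighbourhoods N_w = { φ̂ : W φ ∈ w }, where φ̂ = {z : φ ∈ z}.
-- Membership of a set X ⊆ W in N_w: X equals (extensionally) some φ̂ with W φ ∈ w.
_∈N_ : (World → Set₁) → World → Set₁
X ∈N w = Σ Formula λ φ → (𝖶 φ ∈ w) × (∀ z → (X z → φ ∈ z) × (φ ∈ z → X z))

infix 3 _⊩_
_⊩_ : World → Formula → Set₁
w ⊩ var q = Lift (lsuc 0ℓ) (Val q w)
w ⊩ ⊥' = Lift (lsuc 0ℓ) ⊥
w ⊩ (φ ∧ ψ) = (w ⊩ φ) × (w ⊩ ψ)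
w ⊩ (φ ∨ ψ) = (w ⊩ φ) ⊎ (w ⊩ ψ)
w ⊩ (φ ⇒ ψ) = ∀ v → w ≤ v → v ⊩ φ → v ⊩ ψ
-- w ⊩ W φ iff w ⊩ ¬φ and V(φ) ∈ N_w   (w ⊩ ¬φ unfolded: no v ≥ w forces φ)
w ⊩ 𝖶 φ = (∀ v → w ≤ v → v ⊩ φ → Lift (lsuc 0ℓ) ⊥) × ((λ z → z ⊩ φ) ∈N w)

-- A prime theory avoiding ψ is obtained from any Γ ⊬ ψ by running through an
-- enumeration of all formulas and adding each one that does not make ψ
-- derivable (Lindenbaum). This yields the truth lemma for implication and
-- the completeness of W with respect to the canonical model. For 𝖶 the
-- neighbourhood condition produces a χ with 𝖶 χ ∈ w and φ̂ = χ̂; completeness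
-- turns φ̂ = χ̂ into ⊢ φ ↔ χ, and the congruence rule then gives 𝖶 φ ∈ w.
module Submission where

open import Defs
open import Level using (Level; 0ℓ; lift; lower) renaming (suc to lsuc)
open import Axiom.ExcludedMiddle using (ExcludedMiddle)
open import Data.Product using (_×_; Σ-syntax; ∃-syntax; _,_; proj₁; proj₂)
open import Data.Sum using (_⊎_; inj₁; inj₂)
open import Data.Empty using (⊥-elim)
open import Data.Nat using (ℕ; zero; suc; _⊔_; _≤′_; ≤′-refl; ≤′-step) renaming (_≤_ to _≤ℕ_)
open import Data.Nat.Properties using (≤⇒≤′; m≤m⊔n; m≤n⊔m)
open import Data.List using (List; []; _∷_; map; concat; cartesianProductWith)
open import Data.List.Relation.Unary.Any using (Any; here; there)
open import Data.List.Membership.Propositional renaming (_∈_ to _∈ₗ_)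
open import Data.List.Membership.Propositional.Properties
  using (∈-map⁺; ∈-concat⁺; ∈-cartesianProductWith⁺)
open import Relation.Nullary using (¬_; yes; no)
open import Relation.Nullary.Decidable using (map′)
open import Relation.Unary using (Pred; _⊆_; _∪_; ｛_｝; ∅; ⋃)
open import Relation.Binary.PropositionalEquality using (refl)

private
  variable
    a b φ ψ χ : Formula
    Γ Δ : Theory
    ℓ : Level

excludedMiddle-lower : ExcludedMiddle (lsuc ℓ) → ExcludedMiddle ℓ
excludedMiddle-lower em = map′ lower lift em

Ascending : {A : Set} → (ℕ → Pred A ℓ) → Set ℓ
Ascending P = ∀ n → P n ⊆ P (suc n)

ascending-⊆ : {A : Set} {P : ℕ → Pred A ℓ} → Ascending P → ∀ {m n} → m ≤ℕ n → P m ⊆ P n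
ascending-⊆ {P = P} asc m≤n = go (≤⇒≤′ m≤n)
  where
  go : ∀ {m n} → m ≤′ n → P m ⊆ P n
  go ≤′-refl = λ x → x
  go (≤′-step {n} m≤′n) = λ x → asc n (go m≤′n x)

-- formulasUpTo n lists the formulas of depth < n all of whose variables are < n.
layers : ℕ → List Formula → List (List Formula)
layers n E =
  (var n ∷ ⊥' ∷ E) ∷ map 𝖶 E ∷ cartesianProductWith _∧_ E E ∷
  cartesianProductWith _∨_ E E ∷ cartesianProductWith _⇒_ E E ∷ []

formulasUpTo : ℕ → List Formula
formulasUpTo zero = []
formulasUpTo (suc n) = concat (layers n (formulasUpTo n))

∈-formulasUpTo-suc : ∀ n → Any (φ ∈ₗ_) (layers n (formulasUpTo n)) → φ ∈ₗ formulasUpTo (suc n)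
∈-formulasUpTo-suc n = ∈-concat⁺

formulasUpTo-ascending : Ascending (λ n φ → φ ∈ₗ formulasUpTo n)
formulasUpTo-ascending n p = ∈-formulasUpTo-suc n (here (there (there p)))

formulasUpTo-common : ∃[ m ] a ∈ₗ formulasUpTo m → ∃[ n ] b ∈ₗ formulasUpTo n →
                      ∃[ k ] a ∈ₗ formulasUpTo k × b ∈ₗ formulasUpTo k
formulasUpTo-common (m , p) (n , q) =
  m ⊔ n , ascending-⊆ formulasUpTo-ascending (m≤m⊔n m n) p
        , ascending-⊆ formulasUpTo-ascending (m≤n⊔m m n) q

formulasUpTo-complete : ∀ φ → ∃[ n ] φ ∈ₗ formulasUpTo n
formulasUpTo-complete (var q) = suc q , ∈-formulasUpTo-suc q (here (here refl))
formulasUpTo-complete ⊥' = 1 , ∈-formulasUpTo-suc 0 (here (there (here refl)))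
formulasUpTo-complete (𝖶 a) with formulasUpTo-complete a
... | n , p = suc n , ∈-formulasUpTo-suc n (there (here (∈-map⁺ 𝖶 p)))
formulasUpTo-complete (a ∧ b) with formulasUpTo-common (formulasUpTo-complete a) (formulasUpTo-complete b)
... | n , p , q = suc n , ∈-formulasUpTo-suc n (there (there (here (∈-cartesianProductWith⁺ _∧_ p q))))
formulasUpTo-complete (a ∨ b) with formulasUpTo-common (formulasUpTo-complete a) (formulasUpTo-complete b)
... | n , p , q = suc n , ∈-formulasUpTo-suc n (there (there (there (here (∈-cartesianProductWith⁺ _∨_ p q)))))
formulasUpTo-complete (a ⇒ b) with formulasUpTo-common (formulasUpTo-complete a) (formulasUpTo-complete b)
... | n , p , q = suc n , ∈-formulasUpTo-suc n (there (there (there (there (here (∈-cartesianProductWith⁺ _⇒_ p q))))))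

infix 3 _⊢_

data _⊢_ (Γ : Theory) : Formula → Set where
  hyp : Γ φ → Γ ⊢ φ
  thm : ⊢ φ → Γ ⊢ φ
  app : Γ ⊢ a ⇒ b → Γ ⊢ a → Γ ⊢ b

⊢-mono : Γ ⊆ Δ → Γ ⊢ φ → Δ ⊢ φ
⊢-mono Γ⊆Δ (hyp g) = hyp (Γ⊆Δ g)
⊢-mono Γ⊆Δ (thm t) = thm t
⊢-mono Γ⊆Δ (app d e) = app (⊢-mono Γ⊆Δ d) (⊢-mono Γ⊆Δ e)

⊢-closed : (P : Theory) → (∀ {φ} → ⊢ φ → P φ) → (∀ {a b} → P (a ⇒ b) → P a → P b) →
           Γ ⊆ P → Γ ⊢ φ → P φ
⊢-closed P thm⊆P mp-closed Γ⊆P (hyp g) = Γ⊆P g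
⊢-closed P thm⊆P mp-closed Γ⊆P (thm t) = thm⊆P t
⊢-closed P thm⊆P mp-closed Γ⊆P (app d e) =
  mp-closed (⊢-closed P thm⊆P mp-closed Γ⊆P d) (⊢-closed P thm⊆P mp-closed Γ⊆P e)

∅-⊢ : ∅ ⊢ φ → ⊢ φ
∅-⊢ = ⊢-closed ⊢_ (λ t → t) mp ⊥-elim

⊢-refl : ⊢ (φ ⇒ φ)
⊢-refl {φ} = mp (mp (ax-S {φ} {φ ⇒ φ} {φ}) ax-K) ax-K

deduction : Γ ∪ ｛ a ｝ ⊢ b → Γ ⊢ a ⇒ b
deduction (hyp (inj₁ g)) = app (thm ax-K) (hyp g)
deduction (hyp (inj₂ refl)) = thm ⊢-refl
deduction (thm t) = app (thm ax-K) (thm t)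
deduction (app d e) = app (app (thm ax-S) (deduction d)) (deduction e)

⊢-⋃-compact : (Γ : ℕ → Theory) → Ascending Γ → ⋃ ℕ Γ ⊢ φ → ∃[ n ] Γ n ⊢ φ
⊢-⋃-compact Γ asc (hyp (n , g)) = n , hyp g
⊢-⋃-compact Γ asc (thm t) = 0 , thm t
⊢-⋃-compact Γ asc (app d e) with ⊢-⋃-compact Γ asc d | ⊢-⋃-compact Γ asc e
... | m , d′ | n , e′ =
  m ⊔ n , app (⊢-mono (ascending-⊆ asc (m≤m⊔n m n)) d′) (⊢-mono (ascending-⊆ asc (m≤n⊔m m n)) e′)

prime-if-maximal : ¬ (Γ ⊢ ψ) → (∀ χ → Γ χ ⊎ Γ ⊢ χ ⇒ ψ) → IsPrime Γ
prime-if-maximal {Γ} {ψ} Γ⊬ψ maximal = record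
  { contains-W = λ t → closed (thm t)
  ; closed-mp  = λ g h → closed (app (hyp g) (hyp h))
  ; consistent = λ g → Γ⊬ψ (app (thm ax-⊥E) (hyp g))
  ; prime      = prime
  }
  where
  closed : Γ ⊢ φ → Γ φ
  closed {φ} d with maximal φ
  ... | inj₁ g = g
  ... | inj₂ φ⇒ψ = ⊥-elim (Γ⊬ψ (app φ⇒ψ d))

  prime : Γ (a ∨ b) → Γ a ⊎ Γ b
  prime {a} {b} g with maximal a | maximal b
  ... | inj₁ ga | _ = inj₁ ga
  ... | inj₂ _ | inj₁ gb = inj₂ gb
  ... | inj₂ a⇒ψ | inj₂ b⇒ψ = ⊥-elim (Γ⊬ψ (app (app (app (thm ax-∨E) a⇒ψ) b⇒ψ) (hyp g)))

module Lindenbaum (em : ExcludedMiddle 0ℓ) (ψ : Formula) where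

  insert : Theory → Formula → Theory
  insert Γ χ with em {Γ ⊢ χ ⇒ ψ}
  ... | yes _ = Γ
  ... | no _ = Γ ∪ ｛ χ ｝

  insert-⊇ : Γ ⊆ insert Γ χ
  insert-⊇ {Γ} {χ} g with em {Γ ⊢ χ ⇒ ψ}
  ... | yes _ = g
  ... | no _ = inj₁ g

  insert-⊬ : ¬ (Γ ⊢ ψ) → ¬ (insert Γ χ ⊢ ψ)
  insert-⊬ {Γ} {χ} Γ⊬ψ with em {Γ ⊢ χ ⇒ ψ}
  ... | yes _ = Γ⊬ψ
  ... | no Γ⊬χ⇒ψ = λ d → Γ⊬χ⇒ψ (deduction d)

  insert-decides : insert Γ χ χ ⊎ Γ ⊢ χ ⇒ ψ
  insert-decides {Γ} {χ} with em {Γ ⊢ χ ⇒ ψ}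
  ... | yes χ⇒ψ = inj₂ χ⇒ψ
  ... | no _ = inj₁ (inj₂ refl)

  insertAll : Theory → List Formula → Theory
  insertAll Γ [] = Γ
  insertAll Γ (χ ∷ χs) = insertAll (insert Γ χ) χs

  insertAll-⊇ : ∀ χs → Γ ⊆ insertAll Γ χs
  insertAll-⊇ [] g = g
  insertAll-⊇ (χ ∷ χs) g = insertAll-⊇ χs (insert-⊇ g)

  insertAll-⊬ : ∀ χs → ¬ (Γ ⊢ ψ) → ¬ (insertAll Γ χs ⊢ ψ)
  insertAll-⊬ [] Γ⊬ψ = Γ⊬ψ
  insertAll-⊬ (χ ∷ χs) Γ⊬ψ = insertAll-⊬ χs (insert-⊬ Γ⊬ψ)

  insertAll-decides : ∀ χs → χ ∈ₗ χs → insertAll Γ χs χ ⊎ insertAll Γ χs ⊢ χ ⇒ ψ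
  insertAll-decides (χ ∷ χs) (here refl) with insert-decides
  ... | inj₁ g = inj₁ (insertAll-⊇ χs g)
  ... | inj₂ χ⇒ψ = inj₂ (⊢-mono (λ g → insertAll-⊇ χs (insert-⊇ g)) χ⇒ψ)
  insertAll-decides (_ ∷ χs) (there p) = insertAll-decides χs p

  stage : Theory → ℕ → Theory
  stage Γ zero = Γ
  stage Γ (suc n) = insertAll (stage Γ n) (formulasUpTo n)

  stage-ascending : Ascending (stage Γ)
  stage-ascending n = insertAll-⊇ (formulasUpTo n)

  stage-⊬ : ¬ (Γ ⊢ ψ) → ∀ n → ¬ (stage Γ n ⊢ ψ)
  stage-⊬ Γ⊬ψ zero = Γ⊬ψ
  stage-⊬ Γ⊬ψ (suc n) = insertAll-⊬ (formulasUpTo n) (stage-⊬ Γ⊬ψ n)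

  limit : Theory → Theory
  limit Γ = ⋃ ℕ (stage Γ)

  limit-⊬ : ¬ (Γ ⊢ ψ) → ¬ (limit Γ ⊢ ψ)
  limit-⊬ {Γ} Γ⊬ψ d with ⊢-⋃-compact (stage Γ) stage-ascending d
  ... | n , dₙ = stage-⊬ Γ⊬ψ n dₙ

  limit-maximal : ∀ χ → limit Γ χ ⊎ limit Γ ⊢ χ ⇒ ψ
  limit-maximal {Γ} χ with formulasUpTo-complete χ
  ... | n , p with insertAll-decides {Γ = stage Γ n} (formulasUpTo n) p
  ...   | inj₁ g = inj₁ (suc n , g)
  ...   | inj₂ χ⇒ψ = inj₂ (⊢-mono (λ g → suc n , g) χ⇒ψ)

lindenbaum : ExcludedMiddle 0ℓ → ¬ (Γ ⊢ ψ) → Σ[ w ∈ World ] Γ ⊆ proj₁ w × ¬ (ψ ∈ w)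
lindenbaum {Γ} {ψ} em Γ⊬ψ =
  (limit Γ , prime-if-maximal (limit-⊬ Γ⊬ψ) limit-maximal) , (λ g → 0 , g) , λ g → limit-⊬ Γ⊬ψ (hyp g)
  where open Lindenbaum em ψ

⊢-⇒-complete : ExcludedMiddle 0ℓ → (∀ (u : World) → Γ ⊆ proj₁ u → a ∈ u → b ∈ u) → Γ ⊢ a ⇒ b
⊢-⇒-complete {Γ} {a} {b} em valid with em {Γ ⊢ a ⇒ b}
... | yes d = d
... | no Γ⊬a⇒b with lindenbaum {Γ ∪ ｛ a ｝} em (λ d → Γ⊬a⇒b (deduction d))
...   | u , Γa⊆u , b∉u = ⊥-elim (b∉u (valid u (λ g → Γa⊆u (inj₁ g)) (Γa⊆u (inj₂ refl))))

⊢-complete : ExcludedMiddle 0ℓ → (∀ (u : World) → a ∈ u → b ∈ u) → ⊢ (a ⇒ b)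
⊢-complete em valid = ∅-⊢ (⊢-⇒-complete em (λ u _ → valid u))

∈-closed : (w : World) → proj₁ w ⊢ φ → φ ∈ w
∈-closed (w , w-prime) = ⊢-closed w contains-W closed-mp (λ g → g)
  where open IsPrime w-prime

∈-by : (w : World) → ⊢ (a ⇒ b) → a ∈ w → b ∈ w
∈-by w t g = ∈-closed w (app (thm t) (hyp g))

Truth : Formula → Set₁
Truth γ = ∀ (w : World) → ((w ⊩ γ) → γ ∈ w) × (γ ∈ w → (w ⊩ γ))

truth-var : ∀ q → Truth (var q)
truth-var q w = lower , lift

truth-⊥ : Truth ⊥'
truth-⊥ w = (λ ()) , λ g → ⊥-elim (IsPrime.consistent (proj₂ w) g)

truth-∧ : Truth a → Truth b → Truth (a ∧ b)
truth-∧ truth-a truth-b w =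
  (λ (fa , fb) → ∈-closed w (app (app (thm ax-∧I) (hyp (proj₁ (truth-a w) fa))) (hyp (proj₁ (truth-b w) fb)))) ,
  λ g → proj₂ (truth-a w) (∈-by w ax-∧E₁ g) , proj₂ (truth-b w) (∈-by w ax-∧E₂ g)

truth-∨ : Truth a → Truth b → Truth (a ∨ b)
truth-∨ {a} {b} truth-a truth-b w = to , from
  where
  to : w ⊩ a ∨ b → (a ∨ b) ∈ w
  to (inj₁ fa) = ∈-by w ax-∨I₁ (proj₁ (truth-a w) fa)
  to (inj₂ fb) = ∈-by w ax-∨I₂ (proj₁ (truth-b w) fb)
  from : (a ∨ b) ∈ w → w ⊩ a ∨ b
  from g with IsPrime.prime (proj₂ w) g
  ... | inj₁ ga = inj₁ (proj₂ (truth-a w) ga)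
  ... | inj₂ gb = inj₂ (proj₂ (truth-b w) gb)

truth-⇒ : ExcludedMiddle 0ℓ → Truth a → Truth b → Truth (a ⇒ b)
truth-⇒ em truth-a truth-b w =
  (λ f → ∈-closed w (⊢-⇒-complete em λ u w⊆u ga →
           proj₁ (truth-b u) (f u (λ _ → w⊆u) (proj₂ (truth-a u) ga)))) ,
  λ g u w≤u fa → proj₂ (truth-b u) (IsPrime.closed-mp (proj₂ u) (w≤u _ g) (proj₁ (truth-a u) fa))

truth-𝖶 : ExcludedMiddle 0ℓ → Truth a → Truth (𝖶 a)
truth-𝖶 {a} em truth-a w = to , from
  where
  to : w ⊩ 𝖶 a → 𝖶 a ∈ w
  to (_ , χ , 𝖶χ∈w , V-a≐χ̂) = ∈-by w (mp ax-∧E₂ (re (mp (mp ax-∧I a⇒χ) χ⇒a))) 𝖶χ∈w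
    where
    a⇒χ : ⊢ (a ⇒ χ)
    a⇒χ = ⊢-complete em λ z ga → proj₁ (V-a≐χ̂ z) (proj₂ (truth-a z) ga)
    χ⇒a : ⊢ (χ ⇒ a)
    χ⇒a = ⊢-complete em λ z gχ → proj₁ (truth-a z) (proj₂ (V-a≐χ̂ z) gχ)

  from : 𝖶 a ∈ w → w ⊩ 𝖶 a
  from g =
    (λ u w≤u fa → lift (IsPrime.consistent (proj₂ u) (IsPrime.closed-mp (proj₂ u)
                   (∈-by u ax-W (w≤u _ g)) (proj₁ (truth-a u) fa)))) ,
    (a , g , λ z → truth-a z)

mainTheorem3 : ExcludedMiddle (lsuc 0ℓ) →
    ∀ (γ : Formula) (w : World) → ((w ⊩ γ) → γ ∈ w) × (γ ∈ w → (w ⊩ γ))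
mainTheorem3 em (var q) = truth-var q
mainTheorem3 em ⊥' = truth-⊥
mainTheorem3 em (a ∧ b) = truth-∧ (mainTheorem3 em a) (mainTheorem3 em b)
mainTheorem3 em (a ∨ b) = truth-∨ (mainTheorem3 em a) (mainTheorem3 em b)
mainTheorem3 em (a ⇒ b) = truth-⇒ (excludedMiddle-lower em) (mainTheorem3 em a) (mainTheorem3 em b)
mainTheorem3 em (𝖶 a) = truth-𝖶 (excludedMiddle-lower em) (mainTheorem3 em a)
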